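{- Let $d \ge 1$ be an integer and let $D$ be a simple Eulerian digraph with minimum in-degree at least $2d$. Then either $D$ immerses a simple $2d$-regular Eulerian digraph (every vertex has in-degree and out-degree exactly $2d$), or $D$ immerses $\overrightarrow{K}_{d,d}$.
   Context: A simple digraph has no loops and at most one copy of the edge $xy$ for each ordered pair $(x,y)$ (both $xy$ and $yx$ may be present). A digraph is Eulerian if every vertex has in-degree equal to its out-degree. $\overrightarrow{K}_{d,d}$ is the digraph on $2d$ vertices consisting of two disjoint independent sets $A$, $B$ of size $d$ and all edges from $A$ to $B$. A digraph $G$ immerses $H$ if there is an injective map $f: V(H)\to V(G)$ and pairwise edge-disjoint directed paths $P_e$ in $G$, one for each edge $e=uv$ of $H$, with $P_e$ going from $f(u)$ to $f(v)$. -}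

module Defs where

open import Data.Nat using (ℕ; zero; suc; _+_; _*_; _≤_; _<ᵇ_)
open import Data.Bool using (Bool; true; false; if_then_else_; _∧_; not)
open import Data.Fin using (Fin; toℕ)
open import Data.List using (List; []; _∷_; map; allFin)
open import Data.Nat.ListAction using (sum)
open import Data.List.Relation.Unary.Unique.Propositional using (Unique)
open import Data.Product using (Σ; _×_; _,_)
open import Relation.Binary.PropositionalEquality using (_≡_; _≢_; refl)
open import Relation.Nullary using (¬_)
open import Function.Definitions using (Injective)

-- A finite simple digraph: vertex set Fin size, adjacency given by a Bool
-- matrix (so at most one copy of each ordered pair xy), and no loops.
record Digraph : Set where
  field
    size     : ℕ
    adj      : Fin size → Fin size → Bool
    loopless : ∀ x → adj x x ≡ false
open Digraph public

indicator : Bool → ℕ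
indicator true  = 1
indicator false = 0

outdeg : (G : Digraph) → Fin (size G) → ℕ
outdeg G x = sum (map (λ y → indicator (adj G x y)) (allFin (size G)))

indeg : (G : Digraph) → Fin (size G) → ℕ
indeg G x = sum (map (λ y → indicator (adj G y x)) (allFin (size G)))

Eulerian : Digraph → Set
Eulerian G = ∀ x → indeg G x ≡ outdeg G x

Regular : ℕ → Digraph → Set
Regular k G = ∀ x → (indeg G x ≡ k) × (outdeg G x ≡ k)

NonEmpty : Digraph → Set
NonEmpty G = Σ (Fin (size G)) (λ _ → Data.Unit.⊤)
  where import Data.Unit

data Walk (G : Digraph) : Fin (size G) → Fin (size G) → Set where
  [] : ∀ {x} → Walk G x x
  _∷⟨_⟩_ : ∀ {x y} z → adj G x z ≡ true → Walk G z y → Walk G x y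

vertices : ∀ {G x y} → Walk G x y → List (Fin (size G))
vertices {x = x} [] = x ∷ []
vertices {x = x} (z ∷⟨ _ ⟩ w) = x ∷ vertices w

data UsesEdge {G : Digraph} (a b : Fin (size G)) :
       ∀ {x y} → Walk G x y → Set where
  here  : ∀ {y} (e : adj G a b ≡ true) (w : Walk G b y) →
          UsesEdge a b (b ∷⟨ e ⟩ w)
  there : ∀ {x z y} (e : adj G x z ≡ true) (w : Walk G z y) →
          UsesEdge a b w → UsesEdge a b (z ∷⟨ e ⟩ w)

record Path (G : Digraph) (x y : Fin (size G)) : Set where
  constructor path
  field
    walk     : Walk G x y
    distinct : Unique (vertices walk)
open Path public

Immerses : Digraph → Digraph → Set
Immerses G H =
  Σ (Fin (size H) → Fin (size G)) λ f →
    Injective _≡_ _≡_ f ×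
    Σ ((u v : Fin (size H)) → adj H u v ≡ true → Path G (f u) (f v)) λ P →
      ∀ u v (e : adj H u v ≡ true) u' v' (e' : adj H u' v' ≡ true) →
        ¬ ((u ≡ u') × (v ≡ v')) →
        ∀ a b → UsesEdge a b (walk (P u v e)) → ¬ UsesEdge a b (walk (P u' v' e'))

-- K→_{d,d}: vertices Fin (d + d); A = {i | i < d}, B = {i | d ≤ i}; all edges A → B
private
  b∧notb : ∀ b → (b ∧ not b) ≡ false
  b∧notb true = refl
  b∧notb false = refl

Kdd : ℕ → Digraph
Kdd d = record
  { size = d + d
  ; adj = λ x y → (toℕ x <ᵇ d) ∧ not (toℕ y <ᵇ d)
  ; loopless = λ x → b∧notb (toℕ x <ᵇ d)
  }

-- Induct on the number of edges. If every vertex has in-degree exactly 2d, then D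
-- itself is the required 2d-regular Eulerian digraph. Otherwise pick v with
-- in-degree > 2d. If some in-neighbour u and out-neighbour w of v are distinct
-- and uw is not an edge, split off the pair uv, vw (replace them by uw): the
-- result is still simple and Eulerian, has minimum in-degree ≥ 2d and fewer
-- edges, and every immersion in it lifts to D by routing uw through v. If no
-- such pair exists, every in-neighbour of v sends an edge to every other
-- out-neighbour of v, and d in-neighbours together with d further
-- out-neighbours span a copy of K→_{d,d}.
module Submission where

open import Defs
open import Data.Nat.Properties
  using (+-0-commutativeMonoid; +-comm; +-assoc; +-identityʳ; +-cancelʳ-≡; +-cancelˡ-≤; +-mono-≤;
         ≤-trans; ≤-reflexive; ≤-antisym; m≤m+n; <ᵇ⇒<; <⇒<ᵇ; ≮⇒≥; module ≤-Reasoning)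
open import Algebra.Properties.CommutativeMonoid.Sum +-0-commutativeMonoid
  using (sum; ∑-distrib-+; sum-cong-≗; sum-replicate-zero)
open import Data.Bool using (Bool; true; false; _∧_; _∨_; not; T; if_then_else_)
open import Data.Bool.Properties using (∧-identityʳ; ∧-zeroʳ) renaming (_≟_ to _≟ᵇ_)
open import Data.Empty using (⊥-elim)
open import Data.Fin using (Fin; zero; suc; toℕ; splitAt; join)
open import Data.Fin.Properties
  using (_≟_; any?; suc-injective; join-splitAt; splitAt-<; splitAt-≥)
open import Data.List using (tabulate)
open import Data.List.Properties using (map-tabulate)
open import Data.List.Relation.Unary.All using ([]; _∷_)
open import Data.List.Relation.Unary.All.Properties.Core using (¬Any⇒All¬)
open import Data.List.Relation.Unary.AllPairs using ([]; _∷_)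
open import Data.List.Relation.Unary.Any using (here; there)
open import Data.List.Relation.Unary.Unique.Propositional using (Unique)
open import Data.Nat using (ℕ; zero; suc; _+_; _*_; _≤_; _<_; _≥_; _<ᵇ_; _<?_; z≤n; s≤s; s≤s⁻¹)
open import Data.Nat.Induction using (<-wellFounded)
import Data.Nat.ListAction as List
open import Data.Product using (Σ; _×_; _,_; proj₁; proj₂; ∃; ∃₂)
import Data.Product as Product
open import Data.Sum using (_⊎_; inj₁; inj₂; [_,_]′)
import Data.Sum as Sum
open import Data.Unit using (tt)
open import Function using (_∘_; id)
open import Function.Definitions using (Injective)
open import Induction.WellFounded using (module All)
open import Level using (0ℓ)
import Relation.Binary.Construct.On as On
open import Relation.Binary.PropositionalEquality
open import Relation.Nullary using (Dec; does; yes; no; ¬_; ¬?; _×-dec_)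
open import Relation.Nullary.Decidable using (dec-true; dec-false)

_=ᵇ_ : ∀ {n} → Fin n → Fin n → Bool
x =ᵇ y = does (x ≟ y)

count : ∀ {n} → (Fin n → Bool) → ℕ
count m = sum (indicator ∘ m)

edges : Digraph → ℕ
edges G = sum (indeg G)

sum-mono-≤ : ∀ {n} {f g : Fin n → ℕ} → (∀ i → f i ≤ g i) → sum f ≤ sum g
sum-mono-≤ {zero}  f≤g = z≤n
sum-mono-≤ {suc n} f≤g = +-mono-≤ (f≤g zero) (sum-mono-≤ (f≤g ∘ suc))

sum-tabulate : ∀ {n} (f : Fin n → ℕ) → List.sum (tabulate f) ≡ sum f
sum-tabulate {zero}  f = refl
sum-tabulate {suc n} f = cong (f zero +_) (sum-tabulate (f ∘ suc))

sum-balance : ∀ {n} (f′ f g h k : Fin n → ℕ) {c} →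
  (∀ y → f′ y + g y + h y ≡ f y + k y) → sum g + sum h ≡ sum k + c → sum f′ + c ≡ sum f
sum-balance {n} f′ f g h k {c} pointwise totals = +-cancelʳ-≡ (sum k) _ _ (begin
  sum f′ + c + sum k            ≡⟨ +-assoc (sum f′) c (sum k) ⟩
  sum f′ + (c + sum k)          ≡⟨ cong (sum f′ +_) (trans (+-comm c (sum k)) (sym totals)) ⟩
  sum f′ + (sum g + sum h)      ≡⟨ sym (+-assoc (sum f′) (sum g) (sum h)) ⟩
  sum f′ + sum g + sum h        ≡⟨ cong (_+ sum h) (sym (∑-distrib-+ f′ g)) ⟩
  sum (λ y → f′ y + g y) + sum h ≡⟨ sym (∑-distrib-+ (λ y → f′ y + g y) h) ⟩
  sum (λ y → f′ y + g y + h y)  ≡⟨ sum-cong-≗ {n} pointwise ⟩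
  sum (λ y → f y + k y)         ≡⟨ ∑-distrib-+ f k ⟩
  sum f + sum k                 ∎)
  where open ≡-Reasoning

indeg-count : ∀ G x → indeg G x ≡ count (λ y → adj G y x)
indeg-count G x = trans (cong List.sum (map-tabulate id f)) (sum-tabulate f)
  where
  f : Fin (size G) → ℕ
  f y = indicator (adj G y x)

outdeg-count : ∀ G x → outdeg G x ≡ count (adj G x)
outdeg-count G x = trans (cong List.sum (map-tabulate id f)) (sum-tabulate f)
  where
  f : Fin (size G) → ℕ
  f y = indicator (adj G x y)

count-false : ∀ {n} → count {n} (λ _ → false) ≡ 0
count-false {n} = sum-replicate-zero n

count-=ᵇ : ∀ {n} (u : Fin n) → count (_=ᵇ u) ≡ 1
count-=ᵇ {suc n} zero    = cong suc (count-false {n})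
count-=ᵇ {suc n} (suc u) = count-=ᵇ u

count-=ᵇ-∧ˡ : ∀ {n} (u : Fin n) c → count (λ y → (y =ᵇ u) ∧ c) ≡ indicator c
count-=ᵇ-∧ˡ {n} u true  = trans (sum-cong-≗ {n} (cong indicator ∘ ∧-identityʳ ∘ (_=ᵇ u))) (count-=ᵇ u)
count-=ᵇ-∧ˡ {n} u false = trans (sum-cong-≗ {n} (cong indicator ∘ ∧-zeroʳ ∘ (_=ᵇ u))) (count-false {n})

count-=ᵇ-∧ʳ : ∀ {n} (u : Fin n) c → count (λ y → c ∧ (y =ᵇ u)) ≡ indicator c
count-=ᵇ-∧ʳ     u true  = count-=ᵇ u
count-=ᵇ-∧ʳ {n} u false = count-false {n}

∧≡true⇒ : ∀ {x y} → (x ∧ y) ≡ true → x ≡ true × y ≡ true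
∧≡true⇒ {true} {true} _ = refl , refl

not≡true⇒≢true : ∀ {b} → not b ≡ true → b ≢ true
not≡true⇒≢true {false} _ ()

count-≤-∖ : ∀ {n} (p q : Fin n → Bool) → count p ≤ count (λ y → p y ∧ not (q y)) + count q
count-≤-∖ {n} p q = ≤-trans (sum-mono-≤ {n} (λ y → pointwise (p y) (q y)))
                            (≤-reflexive (∑-distrib-+ (indicator ∘ p∖q) (indicator ∘ q)))
  where
  p∖q : Fin n → Bool
  p∖q y = p y ∧ not (q y)
  pointwise : ∀ b c → indicator b ≤ indicator (b ∧ not c) + indicator c
  pointwise true  true  = s≤s z≤n
  pointwise true  false = s≤s z≤n
  pointwise false c     = z≤n

_⇒ᵐ_ : ∀ {n} → (Fin n → Bool) → (Fin n → Bool) → Set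
m′ ⇒ᵐ m = ∀ y → m′ y ≡ true → m y ≡ true

submask-of-count : ∀ {n} (m : Fin n → Bool) k → k ≤ count m →
  Σ (Fin n → Bool) λ m′ → m′ ⇒ᵐ m × count m′ ≡ k
submask-of-count {n} m zero _ = (λ _ → false) , (λ _ ()) , count-false {n}
submask-of-count {suc n} m (suc k) k<count with m zero in m0
... | true with submask-of-count (m ∘ suc) k (s≤s⁻¹ k<count)
...   | m′ , m′⇒m , count≡k =
  (λ { zero → true ; (suc y) → m′ y }) , (λ { zero _ → m0 ; (suc y) → m′⇒m y }) , cong suc count≡k
submask-of-count {suc n} m (suc k) k<count | false
  with submask-of-count (m ∘ suc) (suc k) k<count
... | m′ , m′⇒m , count≡k =
  (λ { zero → false ; (suc y) → m′ y }) , (λ { zero () ; (suc y) → m′⇒m y }) , count≡k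

injection-into-mask : ∀ {n} (m : Fin n → Bool) k → k ≤ count m →
  Σ (Fin k → Fin n) λ g → Injective _≡_ _≡_ g × (∀ i → m (g i) ≡ true)
injection-into-mask m zero _ = (λ ()) , (λ { {()} }) , λ ()
injection-into-mask {suc n} m (suc k) k<count with m zero in m0
... | true with injection-into-mask (m ∘ suc) k (s≤s⁻¹ k<count)
...   | g , g-inj , g∈m = g′ , g′-inj , g′∈m
  where
  g′ : Fin (suc k) → Fin (suc n)
  g′ zero    = zero
  g′ (suc i) = suc (g i)
  g′-inj : Injective _≡_ _≡_ g′
  g′-inj {zero}  {zero}  _  = refl
  g′-inj {suc i} {suc j} eq = cong suc (g-inj (suc-injective eq))
  g′∈m : ∀ i → m (g′ i) ≡ true
  g′∈m zero    = m0
  g′∈m (suc i) = g∈m i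
injection-into-mask {suc n} m (suc k) k<count | false
  with injection-into-mask (m ∘ suc) (suc k) k<count
... | g , g-inj , g∈m = suc ∘ g , g-inj ∘ suc-injective , g∈m

module _ {G : Digraph} where
  open import Data.List.Membership.DecPropositional (_≟_ {size G}) using (_∈_; _∈?_)

  UsesEdge⇒adj : ∀ {a b x y} {ω : Walk G x y} → UsesEdge a b ω → adj G a b ≡ true
  UsesEdge⇒adj (here e _)    = e
  UsesEdge⇒adj (there _ _ r) = UsesEdge⇒adj r

  _⊆ᴱ_ : ∀ {x y x′ y′} → Walk G x y → Walk G x′ y′ → Set
  ω ⊆ᴱ ω′ = ∀ a b → UsesEdge a b ω → UsesEdge a b ω′

  suffix-from : ∀ {x z y} (ω : Walk G z y) → x ∈ vertices ω →
    Σ (Walk G x y) λ ω′ → (Unique (vertices ω) → Unique (vertices ω′)) × ω′ ⊆ᴱ ω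
  suffix-from []            (here refl) = [] , id , λ _ _ r → r
  suffix-from (z ∷⟨ e ⟩ ω) (here refl) = z ∷⟨ e ⟩ ω , id , λ _ _ r → r
  suffix-from (z ∷⟨ e ⟩ ω) (there x∈ω) with suffix-from ω x∈ω
  ... | ω′ , unique , ω′⊆ω = ω′ , (λ { (_ ∷ u) → unique u }) , λ a b r → there e ω (ω′⊆ω a b r)

  walk⇒path : ∀ {x y} (ω : Walk G x y) → Σ (Path G x y) λ p → walk p ⊆ᴱ ω
  walk⇒path [] = path [] ([] ∷ []) , λ _ _ ()
  walk⇒path {x} (z ∷⟨ e ⟩ ω) with walk⇒path ω
  ... | path p unique , p⊆ω with x ∈? vertices p
  ...   | yes x∈p with suffix-from p x∈p
  ...     | p′ , unique′ , p′⊆p = path p′ (unique′ unique) , λ a b r → there e ω (p⊆ω a b (p′⊆p a b r))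
  walk⇒path {x} (z ∷⟨ e ⟩ ω) | path p unique , p⊆ω | no x∉p =
    path (z ∷⟨ e ⟩ p) (¬Any⇒All¬ (vertices p) x∉p ∷ unique) , extend
    where
    extend : (z ∷⟨ e ⟩ p) ⊆ᴱ (z ∷⟨ e ⟩ ω)
    extend a b (here _ _)    = here e ω
    extend a b (there _ _ r) = there e ω (p⊆ω a b r)

  UsesEdge-edge : ∀ {x z a b} (e : adj G x z ≡ true) →
    UsesEdge a b (_∷⟨_⟩_ {G} {x} z e []) → (a ≡ x) × (b ≡ z)
  UsesEdge-edge e (here _ _) = refl , refl

adj⇒≢ : ∀ (G : Digraph) {x y} → adj G x y ≡ true → x ≢ y
adj⇒≢ G e refl with () ← trans (sym e) (loopless G _)

subgraph⇒Immerses : ∀ {G H} (f : Fin (size H) → Fin (size G)) → Injective _≡_ _≡_ f →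
  (∀ a b → adj H a b ≡ true → adj G (f a) (f b) ≡ true) → Immerses G H
subgraph⇒Immerses {G} {H} f f-inj f-hom = f , f-inj , P , disjoint
  where
  P : ∀ a b → adj H a b ≡ true → Path G (f a) (f b)
  P a b e = path (f b ∷⟨ f-hom a b e ⟩ []) (((adj⇒≢ H e ∘ f-inj) ∷ []) ∷ [] ∷ [])
  disjoint : ∀ a b (e : adj H a b ≡ true) a′ b′ (e′ : adj H a′ b′ ≡ true) → ¬ ((a ≡ a′) × (b ≡ b′)) →
    ∀ p q → UsesEdge p q (walk (P a b e)) → ¬ UsesEdge p q (walk (P a′ b′ e′))
  disjoint a b e a′ b′ e′ distinct p q r r′
    with UsesEdge-edge (f-hom a b e) r | UsesEdge-edge (f-hom a′ b′ e′) r′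
  ... | refl , refl | p≡ , q≡ = distinct (f-inj p≡ , f-inj q≡)

Immerses-refl : ∀ G → Immerses G G
Immerses-refl G = subgraph⇒Immerses {G} {G} id id (λ _ _ e → e)

[,]-injective : ∀ {A B C : Set} {α : A → C} {β : B → C} →
  Injective _≡_ _≡_ α → Injective _≡_ _≡_ β → (∀ a b → α a ≢ β b) → Injective _≡_ _≡_ [ α , β ]′
[,]-injective α-inj β-inj disjoint {inj₁ a} {inj₁ a′} eq = cong inj₁ (α-inj eq)
[,]-injective α-inj β-inj disjoint {inj₁ a} {inj₂ b′} eq = ⊥-elim (disjoint a b′ eq)
[,]-injective α-inj β-inj disjoint {inj₂ b} {inj₁ a′} eq = ⊥-elim (disjoint a′ b (sym eq))
[,]-injective α-inj β-inj disjoint {inj₂ b} {inj₂ b′} eq = cong inj₂ (β-inj eq)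

splitAt-injective : ∀ m {n} → Injective _≡_ _≡_ (splitAt m {n})
splitAt-injective m {n} {i} {j} eq =
  trans (sym (join-splitAt m n i)) (trans (cong (join m n) eq) (join-splitAt m n j))

Kdd-adj⇒sides : ∀ {d} (a b : Fin (d + d)) → adj (Kdd d) a b ≡ true → toℕ a < d × d ≤ toℕ b
Kdd-adj⇒sides {d} a b e with toℕ a <ᵇ d in a<ᵇd | toℕ b <ᵇ d in b<ᵇd
... | true | false = <ᵇ⇒< (toℕ a) d (subst T (sym a<ᵇd) tt) , ≮⇒≥ (λ b<d → subst T b<ᵇd (<⇒<ᵇ b<d))

bipartite⇒Immerses-Kdd : ∀ {d} (G : Digraph) (α β : Fin d → Fin (size G)) →
  Injective _≡_ _≡_ α → Injective _≡_ _≡_ β → (∀ i j → α i ≢ β j) →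
  (∀ i j → adj G (α i) (β j) ≡ true) → Immerses G (Kdd d)
bipartite⇒Immerses-Kdd {d} G α β α-inj β-inj disjoint complete =
  subgraph⇒Immerses {G} {Kdd d} f f-inj f-hom
  where
  f : Fin (d + d) → Fin (size G)
  f = [ α , β ]′ ∘ splitAt d
  f-inj : Injective _≡_ _≡_ f
  f-inj = splitAt-injective d ∘ [,]-injective α-inj β-inj disjoint
  f-hom : ∀ a b → adj (Kdd d) a b ≡ true → adj G (f a) (f b) ≡ true
  f-hom a b e with Kdd-adj⇒sides a b e
  ... | a<d , d≤b rewrite splitAt-< d a a<d | splitAt-≥ d b d≤b = complete _ _

count-out-neighbours-outside : ∀ {k} G v (A : Fin (size G) → Bool) → count A + k ≤ outdeg G v →
  k ≤ count (λ y → adj G v y ∧ not (A y))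
count-out-neighbours-outside {k} G v A bound = +-cancelˡ-≤ (count A) k _ (begin
  count A + k                                          ≤⟨ bound ⟩
  outdeg G v                                           ≡⟨ outdeg-count G v ⟩
  count (adj G v)                                      ≤⟨ count-≤-∖ (adj G v) A ⟩
  count (λ y → adj G v y ∧ not (A y)) + count A       ≡⟨ +-comm _ (count A) ⟩
  count A + count (λ y → adj G v y ∧ not (A y))       ∎)
  where open ≤-Reasoning

disjoint-neighbours : ∀ d G v → d ≤ indeg G v → 2 * d ≤ outdeg G v →
  Σ (Fin d → Fin (size G)) λ α → Σ (Fin d → Fin (size G)) λ β →
    Injective _≡_ _≡_ α × Injective _≡_ _≡_ β × (∀ i j → α i ≢ β j) ×
    (∀ i → adj G (α i) v ≡ true) × (∀ j → adj G v (β j) ≡ true)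
disjoint-neighbours d G v d≤indeg 2d≤outdeg
  with submask-of-count (λ y → adj G y v) d (≤-trans d≤indeg (≤-reflexive (indeg-count G v)))
... | A , A⇒in , count-A≡d
  with injection-into-mask A d (≤-reflexive (sym count-A≡d))
     | injection-into-mask (λ y → adj G v y ∧ not (A y)) d
         (count-out-neighbours-outside G v A
           (subst (_≤ outdeg G v) (cong₂ _+_ (sym count-A≡d) (+-identityʳ d)) 2d≤outdeg))
... | α , α-inj , α∈A | β , β-inj , β∈B =
  α , β , α-inj , β-inj , disjoint , (λ i → A⇒in (α i) (α∈A i)) , (λ j → proj₁ (∧≡true⇒ (β∈B j)))
  where
  disjoint : ∀ i j → α i ≢ β j
  disjoint i j αi≡βj = not≡true⇒≢true (proj₂ (∧≡true⇒ (β∈B j))) (trans (cong A (sym αi≡βj)) (α∈A i))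

Unsplittable : (G : Digraph) → Fin (size G) → Set
Unsplittable G v = ∀ a b → adj G a v ≡ true → adj G v b ≡ true → a ≢ b → adj G a b ≡ true

Splittable : (G : Digraph) → Fin (size G) → Fin (size G) → Fin (size G) → Set
Splittable G v a b = adj G a v ≡ true × adj G v b ≡ true × a ≢ b × adj G a b ≡ false

splittable? : ∀ G v a b → Dec (Splittable G v a b)
splittable? G v a b = adj G a v ≟ᵇ true ×-dec adj G v b ≟ᵇ true ×-dec ¬? (a ≟ b) ×-dec adj G a b ≟ᵇ false

unsplittable-or-splittable : ∀ G v → Unsplittable G v ⊎ ∃₂ (Splittable G v)
unsplittable-or-splittable G v with any? (λ a → any? (splittable? G v a))
... | yes (a , b , split) = inj₂ (a , b , split)
... | no ¬split = inj₁ unsplittable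
  where
  unsplittable : Unsplittable G v
  unsplittable a b av vb a≢b with adj G a b in ab
  ... | true  = refl
  ... | false = ⊥-elim (¬split (a , b , av , vb , a≢b , ab))

unsplittable⇒Immerses-Kdd : ∀ d (G : Digraph) v → d ≤ indeg G v → 2 * d ≤ outdeg G v →
  Unsplittable G v → Immerses G (Kdd d)
unsplittable⇒Immerses-Kdd d G v d≤indeg 2d≤outdeg unsplittable
  with disjoint-neighbours d G v d≤indeg 2d≤outdeg
... | α , β , α-inj , β-inj , disjoint , α→v , v→β =
  bipartite⇒Immerses-Kdd G α β α-inj β-inj disjoint
    (λ i j → unsplittable (α i) (β j) (α→v i) (v→β j) (disjoint i j))

module SplitOff (D : Digraph) {u v w : Fin (size D)}
  (uv : adj D u v ≡ true) (vw : adj D v w ≡ true) (u≢w : u ≢ w) (¬uw : adj D u w ≡ false) where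

  u≢v : u ≢ v
  u≢v = adj⇒≢ D uv

  v≢w : v ≢ w
  v≢w = adj⇒≢ D vw

  adj′ : Fin (size D) → Fin (size D) → Bool
  adj′ a b = if (a =ᵇ u) ∧ (b =ᵇ w) then true
             else if ((a =ᵇ u) ∧ (b =ᵇ v)) ∨ ((a =ᵇ v) ∧ (b =ᵇ w)) then false
             else adj D a b

  loopless′ : ∀ a → adj′ a a ≡ false
  loopless′ a with a ≟ u | a ≟ w | a ≟ v
  ... | yes refl | yes a≡w | _     = ⊥-elim (u≢w a≡w)
  ... | yes _    | no _    | yes _ = refl
  ... | yes _    | no _    | no _  = loopless D a
  ... | no _     | yes _   | yes _ = refl
  ... | no _     | yes _   | no _  = loopless D a
  ... | no _     | no _    | yes _ = loopless D a
  ... | no _     | no _    | no _  = loopless D a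

  D′ : Digraph
  D′ = record { size = size D ; adj = adj′ ; loopless = loopless′ }

  adj′-balance : ∀ a b →
    indicator (adj′ a b) + indicator ((a =ᵇ u) ∧ (b =ᵇ v)) + indicator ((a =ᵇ v) ∧ (b =ᵇ w))
      ≡ indicator (adj D a b) + indicator ((a =ᵇ u) ∧ (b =ᵇ w))
  adj′-balance a b with a ≟ u | a ≟ v | b ≟ v | b ≟ w
  ... | yes refl | yes u≡v  | _        | _        = ⊥-elim (u≢v u≡v)
  ... | _        | _        | yes refl | yes v≡w  = ⊥-elim (v≢w v≡w)
  ... | yes refl | no _     | yes refl | no _     rewrite uv = refl
  ... | yes refl | no _     | no _     | yes refl rewrite ¬uw = refl
  ... | yes _    | no _     | no _     | no _     = +-identityʳ _
  ... | no _     | yes refl | _        | yes refl rewrite vw = refl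
  ... | no _     | yes _    | _        | no _     = +-identityʳ _
  ... | no _     | no _     | _        | _        = +-identityʳ _

  indeg-D′ : ∀ x → indeg D′ x + indicator (x =ᵇ v) ≡ indeg D x
  indeg-D′ x = begin
    indeg D′ x + indicator (x =ᵇ v)              ≡⟨ cong (_+ indicator (x =ᵇ v)) (indeg-count D′ x) ⟩
    count (λ y → adj′ y x) + indicator (x =ᵇ v)  ≡⟨ sum-balance _ _ _ _ _ (λ y → adj′-balance y x) totals ⟩
    count (λ y → adj D y x)                      ≡⟨ indeg-count D x ⟨
    indeg D x                                    ∎
    where
    open ≡-Reasoning
    totals : count (λ y → (y =ᵇ u) ∧ (x =ᵇ v)) + count (λ y → (y =ᵇ v) ∧ (x =ᵇ w))
             ≡ count (λ y → (y =ᵇ u) ∧ (x =ᵇ w)) + indicator (x =ᵇ v)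
    totals = begin
      count (λ y → (y =ᵇ u) ∧ (x =ᵇ v)) + count (λ y → (y =ᵇ v) ∧ (x =ᵇ w))
        ≡⟨ cong₂ _+_ (count-=ᵇ-∧ˡ u (x =ᵇ v)) (count-=ᵇ-∧ˡ v (x =ᵇ w)) ⟩
      indicator (x =ᵇ v) + indicator (x =ᵇ w)
        ≡⟨ +-comm (indicator (x =ᵇ v)) _ ⟩
      indicator (x =ᵇ w) + indicator (x =ᵇ v)
        ≡⟨ cong (_+ indicator (x =ᵇ v)) (count-=ᵇ-∧ˡ u (x =ᵇ w)) ⟨
      count (λ y → (y =ᵇ u) ∧ (x =ᵇ w)) + indicator (x =ᵇ v) ∎

  outdeg-D′ : ∀ x → outdeg D′ x + indicator (x =ᵇ v) ≡ outdeg D x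
  outdeg-D′ x = begin
    outdeg D′ x + indicator (x =ᵇ v)     ≡⟨ cong (_+ indicator (x =ᵇ v)) (outdeg-count D′ x) ⟩
    count (adj′ x) + indicator (x =ᵇ v)  ≡⟨ sum-balance _ _ _ _ _ (adj′-balance x) totals ⟩
    count (adj D x)                      ≡⟨ outdeg-count D x ⟨
    outdeg D x                           ∎
    where
    open ≡-Reasoning
    totals : count (λ y → (x =ᵇ u) ∧ (y =ᵇ v)) + count (λ y → (x =ᵇ v) ∧ (y =ᵇ w))
             ≡ count (λ y → (x =ᵇ u) ∧ (y =ᵇ w)) + indicator (x =ᵇ v)
    totals = begin
      count (λ y → (x =ᵇ u) ∧ (y =ᵇ v)) + count (λ y → (x =ᵇ v) ∧ (y =ᵇ w))
        ≡⟨ cong₂ _+_ (count-=ᵇ-∧ʳ v (x =ᵇ u)) (count-=ᵇ-∧ʳ w (x =ᵇ v)) ⟩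
      indicator (x =ᵇ u) + indicator (x =ᵇ v)
        ≡⟨ cong (_+ indicator (x =ᵇ v)) (count-=ᵇ-∧ʳ w (x =ᵇ u)) ⟨
      count (λ y → (x =ᵇ u) ∧ (y =ᵇ w)) + indicator (x =ᵇ v) ∎

  Eulerian-D′ : Eulerian D → Eulerian D′
  Eulerian-D′ eulerian x = +-cancelʳ-≡ (indicator (x =ᵇ v)) _ _
    (trans (indeg-D′ x) (trans (eulerian x) (sym (outdeg-D′ x))))

  edges-D′<edges-D : edges D′ < edges D
  edges-D′<edges-D = ≤-reflexive (begin
    suc (edges D′)                               ≡⟨ +-comm 1 (edges D′) ⟩
    edges D′ + 1                                 ≡⟨ cong (edges D′ +_) (count-=ᵇ v) ⟨
    edges D′ + count (_=ᵇ v)                     ≡⟨ ∑-distrib-+ (indeg D′) (indicator ∘ (_=ᵇ v)) ⟨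
    sum (λ x → indeg D′ x + indicator (x =ᵇ v))  ≡⟨ sum-cong-≗ {size D} indeg-D′ ⟩
    edges D                                      ∎)
    where open ≡-Reasoning

  indeg-D′-≥ : ∀ {k} → (∀ x → k ≤ indeg D x) → k < indeg D v → ∀ x → k ≤ indeg D′ x
  indeg-D′-≥ {k} k≤indeg k<indeg-v x with x ≟ v | indeg-D′ x
  ... | yes refl | indeg≡ = s≤s⁻¹ (subst (suc k ≤_) (trans (sym indeg≡) (+-comm _ 1)) k<indeg-v)
  ... | no _     | indeg≡ = subst (k ≤_) (trans (sym indeg≡) (+-identityʳ _)) (k≤indeg x)

  adj′⇒adj : ∀ {a b} → adj′ a b ≡ true → ¬ ((a ≡ u) × (b ≡ w)) → adj D a b ≡ true
  adj′⇒adj {a} {b} e not-uw with a ≟ u | b ≟ w | b ≟ v | a ≟ v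
  ... | yes a≡u | yes b≡w | _     | _     = ⊥-elim (not-uw (a≡u , b≡w))
  ... | yes _   | no _    | no _  | yes _ = e
  ... | yes _   | no _    | no _  | no _  = e
  ... | no _    | yes _   | _     | no _  = e
  ... | no _    | no _    | _     | yes _ = e
  ... | no _    | no _    | _     | no _  = e

  ¬adj′-uv : adj′ u v ≡ false
  ¬adj′-uv rewrite dec-true (u ≟ u) refl | dec-true (v ≟ v) refl | dec-false (v ≟ w) v≢w = refl

  ¬adj′-vw : adj′ v w ≡ false
  ¬adj′-vw rewrite dec-false (v ≟ u) (u≢v ∘ sym) | dec-true (v ≟ v) refl | dec-true (w ≟ w) refl = refl

  lift : ∀ {x y} → Walk D′ x y → Walk D x y
  lift [] = []
  lift {x} (z ∷⟨ e ⟩ ω) with (x ≟ u) ×-dec (z ≟ w)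
  ... | yes (refl , refl) = v ∷⟨ uv ⟩ (w ∷⟨ vw ⟩ lift ω)
  ... | no not-uw        = z ∷⟨ adj′⇒adj e not-uw ⟩ lift ω

  lift-UsesEdge : ∀ {x y} (ω : Walk D′ x y) a b → UsesEdge a b (lift ω) →
    UsesEdge a b ω ⊎ (adj′ a b ≡ false × UsesEdge u w ω)
  lift-UsesEdge [] a b ()
  lift-UsesEdge {x} (z ∷⟨ e ⟩ ω) a b r with (x ≟ u) ×-dec (z ≟ w)
  lift-UsesEdge (z ∷⟨ e ⟩ ω) a b (here _ _)               | yes (refl , refl) = inj₂ (¬adj′-uv , here e ω)
  lift-UsesEdge (z ∷⟨ e ⟩ ω) a b (there _ _ (here _ _))   | yes (refl , refl) = inj₂ (¬adj′-vw , here e ω)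
  lift-UsesEdge (z ∷⟨ e ⟩ ω) a b (there _ _ (there _ _ r)) | yes (refl , refl) =
    Sum.map (there e ω) (Product.map₂ (there e ω)) (lift-UsesEdge ω a b r)
  lift-UsesEdge (z ∷⟨ e ⟩ ω) a b (here _ _)    | no _ = inj₁ (here e ω)
  lift-UsesEdge (z ∷⟨ e ⟩ ω) a b (there _ _ r) | no _ =
    Sum.map (there e ω) (Product.map₂ (there e ω)) (lift-UsesEdge ω a b r)

  -- A D-edge on two lifted paths is either a common D′-edge or, being one of the
  -- non-edges uv, vw of D′, comes from two uses of uw; both contradict disjointness.
  lift-Immerses : ∀ {H} → Immerses D′ H → Immerses D H
  lift-Immerses {H} (f , f-inj , P , disjoint) = f , f-inj , P↑ , disjoint↑
    where
    shortcut : ∀ {a b} (e : adj H a b ≡ true) → Σ (Path D (f a) (f b)) λ p → walk p ⊆ᴱ lift (walk (P a b e))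
    shortcut {a} {b} e = walk⇒path (lift (walk (P a b e)))
    P↑ : ∀ a b → adj H a b ≡ true → Path D (f a) (f b)
    P↑ a b e = proj₁ (shortcut e)
    disjoint↑ : ∀ a b (e : adj H a b ≡ true) a′ b′ (e′ : adj H a′ b′ ≡ true) → ¬ ((a ≡ a′) × (b ≡ b′)) →
      ∀ p q → UsesEdge p q (walk (P↑ a b e)) → ¬ UsesEdge p q (walk (P↑ a′ b′ e′))
    disjoint↑ a b e a′ b′ e′ distinct p q r r′
      with lift-UsesEdge (walk (P a b e)) p q (proj₂ (shortcut e) p q r)
         | lift-UsesEdge (walk (P a′ b′ e′)) p q (proj₂ (shortcut e′) p q r′)
    ... | inj₁ s         | inj₁ s′        = disjoint a b e a′ b′ e′ distinct p q s s′
    ... | inj₂ (_ , s)   | inj₂ (_ , s′)  = disjoint a b e a′ b′ e′ distinct u w s s′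
    ... | inj₁ s         | inj₂ (¬pq , _) with () ← trans (sym (UsesEdge⇒adj s)) ¬pq
    ... | inj₂ (¬pq , _) | inj₁ s′        with () ← trans (sym (UsesEdge⇒adj s′)) ¬pq

Regular-of-indeg-bounds : ∀ {k} G → Eulerian G → (∀ x → k ≤ indeg G x) →
  ¬ (∃ λ x → k < indeg G x) → Regular k G
Regular-of-indeg-bounds {k} G eulerian k≤indeg ¬k<indeg x = indeg≡k , trans (sym (eulerian x)) indeg≡k
  where
  indeg≡k : indeg G x ≡ k
  indeg≡k = ≤-antisym (≮⇒≥ (λ k<indeg → ¬k<indeg (x , k<indeg))) (k≤indeg x)

module _ (d : ℕ) where

  Outcome : Digraph → Set
  Outcome D = Σ Digraph (λ H → NonEmpty H × Regular (2 * d) H × Eulerian H × Immerses D H)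
                ⊎ Immerses D (Kdd d)

  Outcome-transfer : ∀ {D D′} → (∀ {H} → Immerses D′ H → Immerses D H) → Outcome D′ → Outcome D
  Outcome-transfer {D} {D′} lift (inj₁ (H , nonEmpty , regular , eulerian , D′⇝H)) =
    inj₁ (H , nonEmpty , regular , eulerian , lift {H} D′⇝H)
  Outcome-transfer {D} {D′} lift (inj₂ D′⇝Kdd) = inj₂ (lift {Kdd d} D′⇝Kdd)

  OutcomeUnderHypotheses : Digraph → Set
  OutcomeUnderHypotheses D = NonEmpty D → Eulerian D → (∀ x → 2 * d ≤ indeg D x) → Outcome D

  outcome : ∀ D → OutcomeUnderHypotheses D
  outcome = All.wfRec (On.wellFounded edges <-wellFounded) 0ℓ OutcomeUnderHypotheses step
    where
    step : ∀ D → (∀ {D′} → edges D′ < edges D → OutcomeUnderHypotheses D′) → OutcomeUnderHypotheses D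
    step D rec nonEmpty eulerian 2d≤indeg with any? (λ x → 2 * d <? indeg D x)
    ... | no ¬2d<indeg =
      inj₁ (D , nonEmpty , Regular-of-indeg-bounds D eulerian 2d≤indeg ¬2d<indeg , eulerian , Immerses-refl D)
    ... | yes (v , 2d<indeg-v) with unsplittable-or-splittable D v
    ...   | inj₁ unsplittable =
      inj₂ (unsplittable⇒Immerses-Kdd d D v (≤-trans (m≤m+n d _) (2d≤indeg v))
              (subst (2 * d ≤_) (eulerian v) (2d≤indeg v)) unsplittable)
    ...   | inj₂ (a , b , av , vb , a≢b , ¬ab) =
      Outcome-transfer {D} {S.D′} (λ {H} → S.lift-Immerses {H})
        (rec S.edges-D′<edges-D nonEmpty (S.Eulerian-D′ eulerian) (S.indeg-D′-≥ 2d≤indeg 2d<indeg-v))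
      where module S = SplitOff D av vb a≢b ¬ab

lemma2p3 : (d : ℕ) → d ≥ 1 → (D : Digraph) → NonEmpty D → Eulerian D →
           (∀ x → 2 * d ≤ indeg D x) →
           Σ Digraph (λ H → NonEmpty H × Regular (2 * d) H × Eulerian H × Immerses D H)
             ⊎ Immerses D (Kdd d)
lemma2p3 d _ = outcome d
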